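{- Let $X$ be a finite non-empty set and $R$ a monotone transit function on $X$. If $R$ satisfies (w) — for all $x,y,z\in X$, $z\in R(x,y)$ or $y\in R(x,z)$ or $x\in R(y,z)$ — then $R$ satisfies (mm): for all $x,y,u,v\in X$, if $R(x,y)\cap R(u,v)\neq\emptyset$ then there are $p,q\in R(x,y)\cup R(u,v)$ such that $R(x,y)\cup R(u,v)\subseteq R(p,q)$.
   Context: A transit function on a finite non-empty set $X$ is a map $R:X\times X\to 2^X$ such that for all $u,v\in X$: $u\in R(u,v)$, $R(u,v)=R(v,u)$, and $R(u,u)=\{u\}$. $R$ is monotone if for all $u,v,p,q\in X$, $p,q\in R(u,v)$ implies $R(p,q)\subseteq R(u,v)$. -}

module Defs where

open import Data.Nat using (ℕ)
open import Data.Fin using (Fin)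
open import Data.Fin.Subset using (Subset; _∈_; _⊆_; _∩_; _∪_; Nonempty)
open import Data.Product using (_×_; ∃₂)
open import Data.Sum using (_⊎_)
open import Relation.Binary.PropositionalEquality using (_≡_)

-- A finite non-empty set X is represented as Fin n with n ≥ 1
-- (statements below take Fin (suc n)). Subsets of X are Data.Fin.Subset.

record IsTransit {n : ℕ} (R : Fin n → Fin n → Subset n) : Set where
  field
    ext  : ∀ u v → u ∈ R u v
    symm : ∀ u v → R u v ≡ R v u
    idem : ∀ u → R u u ≡ Data.Fin.Subset.⁅ u ⁆

Monotone : {n : ℕ} → (Fin n → Fin n → Subset n) → Set
Monotone R = ∀ u v p q → p ∈ R u v → q ∈ R u v → R p q ⊆ R u v

AxiomW : {n : ℕ} → (Fin n → Fin n → Subset n) → Set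
AxiomW R = ∀ x y z → (z ∈ R x y) ⊎ ((y ∈ R x z) ⊎ (x ∈ R y z))

AxiomMM : {n : ℕ} → (Fin n → Fin n → Subset n) → Set
AxiomMM R = ∀ x y u v → Nonempty (R x y ∩ R u v) →
  ∃₂ λ p q → (p ∈ (R x y ∪ R u v)) × (q ∈ (R x y ∪ R u v))
             × ((R x y ∪ R u v) ⊆ R p q)

{-# OPTIONS --safe #-}
module Submission where

open import Data.Nat using (ℕ; suc)
open import Data.Fin using (Fin)
open import Data.Fin.Subset using (Subset; _∈_; _⊆_; _∪_)
open import Data.Fin.Subset.Properties using (⊆-refl; ⊆-trans; p⊆p∪q; q⊆p∪q; x∈p∪q⁻)
open import Data.Sum using ([_,_]; inj₁; inj₂)
open import Data.Product using (_,_; _×_; ∃₂)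
open import Relation.Binary.PropositionalEquality using (subst)
open import Defs

-- By (w) and monotonicity, for any point v one of R p q, R p v, R q v contains
-- both R p q and v. Enlarging R x y in this way first by u and then by v gives
-- an interval R p q containing x, y, u and v, and by monotonicity it contains
-- R x y ∪ R u v.

module MonotoneTransit {n : ℕ} {R : Fin n → Fin n → Subset n}
                       (transit : IsTransit R) (monotone : Monotone R) where
  open IsTransit transit

  ∈-R-right : ∀ u v → v ∈ R u v
  ∈-R-right u v = subst (v ∈_) (symm v u) (ext v u)

  R-⊆ : ∀ {u v p q} → p ∈ R u v → q ∈ R u v → R p q ⊆ R u v
  R-⊆ {u} {v} {p} {q} = monotone u v p q

  R-∪-⊆ : ∀ {x y u v p q} → x ∈ R p q → y ∈ R p q → u ∈ R p q → v ∈ R p q →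
          R x y ∪ R u v ⊆ R p q
  R-∪-⊆ {x} {y} {u} {v} x∈ y∈ u∈ v∈ w∈ =
    [ R-⊆ x∈ y∈ , R-⊆ u∈ v∈ ] (x∈p∪q⁻ (R x y) (R u v) w∈)

  module _ (axiomW : AxiomW R) where

    R-enlarge : ∀ {U p q v} → p ∈ U → q ∈ U → v ∈ U →
                ∃₂ λ p′ q′ → p′ ∈ U × q′ ∈ U × R p q ⊆ R p′ q′ × v ∈ R p′ q′
    R-enlarge {p = p} {q} {v} p∈U q∈U v∈U with axiomW p q v
    ... | inj₁ v∈Rpq        = p , q , p∈U , q∈U , ⊆-refl , v∈Rpq
    ... | inj₂ (inj₁ q∈Rpv) = p , v , p∈U , v∈U , R-⊆ (ext p v) q∈Rpv , ∈-R-right p v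
    ... | inj₂ (inj₂ p∈Rqv) = q , v , q∈U , v∈U , R-⊆ p∈Rqv (ext q v) , ∈-R-right q v

    axiomMM : AxiomMM R
    axiomMM x y u v _
      with R-enlarge (p⊆p∪q (R u v) (ext x y)) (p⊆p∪q (R u v) (∈-R-right x y))
                     (q⊆p∪q (R x y) (R u v) (ext u v))
    ... | p , q , p∈U , q∈U , Rxy⊆Rpq , u∈Rpq
      with R-enlarge p∈U q∈U (q⊆p∪q (R x y) (R u v) (∈-R-right u v))
    ... | p′ , q′ , p′∈U , q′∈U , Rpq⊆Rp′q′ , v∈Rp′q′ =
      p′ , q′ , p′∈U , q′∈U ,
      R-∪-⊆ (Rxy⊆Rp′q′ (ext x y)) (Rxy⊆Rp′q′ (∈-R-right x y)) (Rpq⊆Rp′q′ u∈Rpq) v∈Rp′q′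
      where
        Rxy⊆Rp′q′ : R x y ⊆ R p′ q′
        Rxy⊆Rp′q′ = ⊆-trans Rxy⊆Rpq Rpq⊆Rp′q′

lemma3 : (n : ℕ) (R : Fin (suc n) → Fin (suc n) → Subset (suc n)) →
    IsTransit R → Monotone R → AxiomW R → AxiomMM R
lemma3 _ _ transit monotone = MonotoneTransit.axiomMM transit monotone
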